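{- Let $\mathcal{A}=\langle A;\Xi\rangle$ be an algebra and assume there is a total order on $A$ which is $\mathcal{A}$-stable. Then a function $f:A\to A$ is $\mathcal{A}$-stable preorder preserving if and only if it is $\mathcal{A}$-stable order preserving.
   Context: An algebra $\langle A;\Xi\rangle$ is a nonempty set $A$ with a set $\Xi$ of operations $\xi:A^{ar(\xi)}\to A$. A binary relation $\rho$ on $A$ is $\mathcal{A}$-stable if for every $\xi\in\Xi$ of arity $m$ and all $x_i,y_i\in A$, $x_1\rho y_1\wedge\cdots\wedge x_m\rho y_m$ implies $\xi(x_1,\ldots,x_m)\,\rho\,\xi(y_1,\ldots,y_m)$. A preorder is a reflexive transitive relation; an order is an antisymmetric preorder. $f:A\to A$ is $\mathcal{A}$-stable preorder (resp. order) preserving if for every $\mathcal{A}$-stable preorder (resp. order) $\preceq$ on $A$, $x\preceq y$ implies $f(x)\preceq f(y)$. -}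

module Defs where

open import Level using (Level; _⊔_; suc)
open import Data.Nat using (ℕ)
open import Data.Fin using (Fin)
open import Relation.Binary.Core using (Rel)
open import Relation.Binary.Structures using (IsPreorder; IsPartialOrder; IsTotalOrder)
open import Relation.Binary.PropositionalEquality using (_≡_)
open import Data.Product using (Σ; _×_)

record Algebra (a o : Level) : Set (Level.suc (a ⊔ o)) where
  field
    Carrier  : Set a
    nonempty : Carrier
    Op       : Set o
    ar       : Op → ℕ
    ⟦_⟧      : (ξ : Op) → (Fin (ar ξ) → Carrier) → Carrier

module _ {a o : Level} (𝒜 : Algebra a o) where
  open Algebra 𝒜

  Stable : {ℓ : Level} → Rel Carrier ℓ → Set (a ⊔ o ⊔ ℓ)
  Stable ρ = (ξ : Op) (x y : Fin (ar ξ) → Carrier) →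
             ((i : Fin (ar ξ)) → ρ (x i) (y i)) → ρ (⟦ ξ ⟧ x) (⟦ ξ ⟧ y)

  StablePreorderPreserving : (ℓ : Level) → (Carrier → Carrier) → Set (a ⊔ o ⊔ Level.suc ℓ)
  StablePreorderPreserving ℓ f =
    (_≼_ : Rel Carrier ℓ) → IsPreorder _≡_ _≼_ → Stable _≼_ →
    ∀ x y → x ≼ y → f x ≼ f y

  StableOrderPreserving : (ℓ : Level) → (Carrier → Carrier) → Set (a ⊔ o ⊔ Level.suc ℓ)
  StableOrderPreserving ℓ f =
    (_≼_ : Rel Carrier ℓ) → IsPartialOrder _≡_ _≼_ → Stable _≼_ →
    ∀ x y → x ≼ y → f x ≼ f y

  HasStableTotalOrder : (ℓ : Level) → Set (a ⊔ o ⊔ Level.suc ℓ)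
  HasStableTotalOrder ℓ =
    Σ (Rel Carrier ℓ) (λ _≤_ → IsTotalOrder _≡_ _≤_ × Stable _≤_)

-- Given a stable preorder ≼ and a stable total order ≤, both ≼ ∩ ≤ and ≼ ∩ ≥ are
-- stable orders (antisymmetry is inherited from ≤), and by totality every pair
-- x ≼ y lies in one of them. An order preserving f therefore maps it into that
-- order, hence in particular into ≼.
module Submission where

open import Defs
open import Level using (Level)
open import Function.Base using (flip)
open import Function.Bundles using (_⇔_; mk⇔)
open import Data.Product using (_,_; proj₁; proj₂)
open import Data.Sum using (inj₁; inj₂)
open import Relation.Binary.Core using (Rel)
open import Relation.Binary.Structures using (IsPreorder; IsPartialOrder; IsTotalOrder)
open import Relation.Binary.PropositionalEquality using (_≡_)
open import Relation.Binary.Construct.Intersection using (_∩_; isPartialOrderʳ)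
import Relation.Binary.Properties.Poset as PosetProperties

isPartialOrder-flip : {a ℓ : Level} {A : Set a} {_≤_ : Rel A ℓ} →
                      IsPartialOrder _≡_ _≤_ → IsPartialOrder _≡_ (flip _≤_)
isPartialOrder-flip O = PosetProperties.≥-isPartialOrder (record { isPartialOrder = O })

module _ {a o : Level} (𝒜 : Algebra a o) where
  open Algebra 𝒜

  Stable-∩ : {ℓ₁ ℓ₂ : Level} (ρ : Rel Carrier ℓ₁) (σ : Rel Carrier ℓ₂) →
             Stable 𝒜 ρ → Stable 𝒜 σ → Stable 𝒜 (ρ ∩ σ)
  Stable-∩ _ _ stρ stσ ξ x y xy =
    stρ ξ x y (λ i → proj₁ (xy i)) , stσ ξ x y (λ i → proj₂ (xy i))

  Stable-flip : {ℓ : Level} (ρ : Rel Carrier ℓ) → Stable 𝒜 ρ → Stable 𝒜 (flip ρ)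
  Stable-flip _ stρ ξ x y yx = stρ ξ y x yx

  stableOrderPreserving⇒stablePreorderPreserving :
    {ℓ : Level} → HasStableTotalOrder 𝒜 ℓ → (f : Carrier → Carrier) →
    StableOrderPreserving 𝒜 ℓ f → StablePreorderPreserving 𝒜 ℓ f
  stableOrderPreserving⇒stablePreorderPreserving (_≤_ , T , st≤) f pres _≼_ P st≼ x y x≼y
    with IsTotalOrder.total T x y
  ... | inj₁ x≤y = proj₁ (pres (_≼_ ∩ _≤_)
                                (isPartialOrderʳ P (IsTotalOrder.isPartialOrder T))
                                (Stable-∩ _≼_ _≤_ st≼ st≤)
                                x y (x≼y , x≤y))
  ... | inj₂ y≤x = proj₁ (pres (_≼_ ∩ flip _≤_)
                                (isPartialOrderʳ P (isPartialOrder-flip (IsTotalOrder.isPartialOrder T)))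
                                (Stable-∩ _≼_ (flip _≤_) st≼ (Stable-flip _≤_ st≤))
                                x y (x≼y , y≤x))

  stablePreorderPreserving⇒stableOrderPreserving :
    {ℓ : Level} (f : Carrier → Carrier) →
    StablePreorderPreserving 𝒜 ℓ f → StableOrderPreserving 𝒜 ℓ f
  stablePreorderPreserving⇒stableOrderPreserving f pres _≼_ O =
    pres _≼_ (IsPartialOrder.isPreorder O)

proposition3p17 : {a o ℓ : Level} (𝒜 : Algebra a o) →
    HasStableTotalOrder 𝒜 ℓ →
    (f : Algebra.Carrier 𝒜 → Algebra.Carrier 𝒜) →
    StablePreorderPreserving 𝒜 ℓ f ⇔ StableOrderPreserving 𝒜 ℓ f
proposition3p17 𝒜 ≤-stableTotal f =
  mk⇔ (stablePreorderPreserving⇒stableOrderPreserving 𝒜 f)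
      (stableOrderPreserving⇒stablePreorderPreserving 𝒜 ≤-stableTotal f)
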